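{- $\mathsf{HS}_{\mathsf{lin}}\not\geq\mathsf{HS}_{\mathsf{st}}$ and $\mathsf{HS}_{\mathsf{lin}}\not\geq\mathsf{HS}_{\mathsf{ct}}$: there is an $\mathsf{HS}$ formula $\psi$ such that no $\mathsf{HS}$ formula $\psi'$ satisfies $K\models_{\mathsf{lin}}\psi'\iff K\models_{\mathsf{st}}\psi$ for all finite Kripke structures $K$, and there is an $\mathsf{HS}$ formula $\chi$ such that no $\mathsf{HS}$ formula $\chi'$ satisfies $K\models_{\mathsf{lin}}\chi'\iff K\models_{\mathsf{ct}}\chi$ for all finite Kripke structures $K$.
   Context: A Kripke structure is $K=(\mathcal{AP},S,\delta,\mu,s_0)$ ($\mathcal{AP}$ finite, left-total $\delta\subseteq S\times S$, $\mu:S\to2^{\mathcal{AP}}$, initial $s_0$); finite if $S$ finite. Infinite paths and traces (non-empty finite paths) follow $\delta$, initial if they start at $s_0$; $\mathrm{lst}(\rho)$ is the last state of a trace. $\mathsf{HS}$: $\psi::=p\mid\neg\psi\mid\psi\wedge\psi\mid\langle B\rangle\psi\mid\langle E\rangle\psi\mid\langle\overline{B}\rangle\psi\mid\langle\overline{E}\rangle\psi$ (other Halpern–Shoham modalities are abbreviations). State-based: on traces, $\rho\models p$ iff $p$ labels every state of $\rho$; $\langle B\rangle$/$\langle E\rangle$: some proper non-empty prefix/suffix satisfies the argument; $\langle\overline{B}\rangle$/$\langle\overline{E}\rangle$: some trace having $\rho$ as proper prefix/suffix satisfies it; $K\models_{\mathsf{st}}\psi$ iff all initial traces satisfy $\psi$.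 Computation-tree-based: $C(K)$ has states the initial traces of $K$, transitions $(\rho,\rho s)$ for $(\mathrm{lst}(\rho),s)\in\delta$, labels $\mu(\mathrm{lst}(\rho))$, initial state $s_0$; $K\models_{\mathsf{ct}}\psi$ iff $C(K)\models_{\mathsf{st}}\psi$. Trace-based: an infinite path $\pi$ induces intervals $[i,j]$ ($i\le j$) labelled $\bigcap_{h=i}^j\mu(\pi(h))$; $\langle B\rangle$: some $[i,j']$, $i\le j'<j$; $\langle E\rangle$: some $[i',j]$, $i<i'\le j$; $\langle\overline{B}\rangle$: some $[i,j']$, $j'>j$; $\langle\overline{E}\rangle$: some $[i',j]$, $i'<i$; $K\models_{\mathsf{lin}}\psi$ iff for every initial infinite path and every $i\ge0$, $[0,i]\models\psi$. -}

module Defs where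

open import Data.Nat using (ℕ; zero; suc; _≤_; _<_)
open import Data.Fin using (Fin)
open import Data.Bool using (Bool; true)
open import Data.List using (List; []; _∷_; _++_; [_])
open import Data.List.Relation.Unary.All using (All)
open import Data.Product using (Σ; _×_; _,_; proj₁; proj₂)
open import Data.Unit using (⊤; tt)
open import Data.Empty using (⊥)
open import Relation.Nullary using (¬_)
open import Relation.Binary.PropositionalEquality using (_≡_; refl)
open import Function.Bundles using (_⇔_)

data HS (n : ℕ) : Set where
  prop  : Fin n → HS n
  neg   : HS n → HS n
  and   : HS n → HS n → HS n
  ⟨B⟩   : HS n → HS n
  ⟨E⟩   : HS n → HS n
  ⟨B̄⟩   : HS n → HS n
  ⟨Ē⟩   : HS n → HS n

record Kripke (n : ℕ) : Set₁ where
  field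
    S     : Set
    δ     : S → S → Set
    μ     : S → Fin n → Bool
    s₀    : S
    total : ∀ s → Σ S λ t → δ s t

IsPath : {S : Set} → (S → S → Set) → List S → Set
IsPath δ []           = ⊥
IsPath δ (x ∷ [])     = ⊤
IsPath δ (x ∷ y ∷ ys) = δ x y × IsPath δ (y ∷ ys)

lst : {S : Set} → S → List S → S
lst x []       = x
lst x (y ∷ ys) = lst y ys

module StateSemantics {n : ℕ} (K : Kripke n) where
  open Kripke K

  sat : List S → HS n → Set
  sat ρ (prop p)  = All (λ s → μ s p ≡ true) ρ
  sat ρ (neg ψ)   = ¬ sat ρ ψ
  sat ρ (and ψ χ) = sat ρ ψ × sat ρ χ
  sat ρ (⟨B⟩ ψ)   = Σ S λ x → Σ (List S) λ xs → Σ S λ y → Σ (List S) λ ys →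
                      (ρ ≡ (x ∷ xs) ++ (y ∷ ys)) × sat (x ∷ xs) ψ
  sat ρ (⟨E⟩ ψ)   = Σ S λ x → Σ (List S) λ xs → Σ S λ y → Σ (List S) λ ys →
                      (ρ ≡ (x ∷ xs) ++ (y ∷ ys)) × sat (y ∷ ys) ψ
  sat ρ (⟨B̄⟩ ψ)   = Σ S λ y → Σ (List S) λ ys →
                      IsPath δ (ρ ++ (y ∷ ys)) × sat (ρ ++ (y ∷ ys)) ψ
  sat ρ (⟨Ē⟩ ψ)   = Σ S λ x → Σ (List S) λ xs →
                      IsPath δ ((x ∷ xs) ++ ρ) × sat ((x ∷ xs) ++ ρ) ψ

_⊨st_ : {n : ℕ} → Kripke n → HS n → Set
K ⊨st ψ = ∀ (r : List S) → IsPath δ (s₀ ∷ r) → sat (s₀ ∷ r) ψ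
  where open Kripke K
        open StateSemantics K

record FinKripke (n : ℕ) : Set where
  field
    m     : ℕ
    δ     : Fin m → Fin m → Bool
    μ     : Fin m → Fin n → Bool
    s₀    : Fin m
    total : ∀ s → Σ (Fin m) λ t → δ s t ≡ true

module _ {n : ℕ} (K : FinKripke n) where
  open FinKripke K

  Δ : Fin m → Fin m → Set
  Δ s t = δ s t ≡ true

  private
    isPath-snoc : ∀ (x : Fin m) xs t → IsPath Δ (x ∷ xs) → Δ (lst x xs) t →
                  IsPath Δ (x ∷ xs ++ [ t ])
    isPath-snoc x []       t p       d = d , tt
    isPath-snoc x (y ∷ ys) t (d' , p) d = d' , isPath-snoc y ys t p d

  asKripke : Kripke n
  asKripke = record { S = Fin m ; δ = Δ ; μ = μ ; s₀ = s₀ ; total = total }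

  -- The computation tree C(K): states are the initial traces s₀ ∷ r of K
  CTState : Set
  CTState = Σ (List (Fin m)) λ r → IsPath Δ (s₀ ∷ r)

  CTδ : CTState → CTState → Set
  CTδ (r , _) (r' , _) = Σ (Fin m) λ s → (r' ≡ r ++ [ s ]) × Δ (lst s₀ r) s

  C : Kripke n
  C = record
    { S     = CTState
    ; δ     = CTδ
    ; μ     = λ ρ → μ (lst s₀ (proj₁ ρ))
    ; s₀    = [] , tt
    ; total = λ { (r , p) →
        let t = proj₁ (total (lst s₀ r)) ; d = proj₂ (total (lst s₀ r)) in
        (r ++ [ t ] , isPath-snoc s₀ r t p d) , t , refl , d }
    }

_⊨ₛₜ_ : {n : ℕ} → FinKripke n → HS n → Set
K ⊨ₛₜ ψ = asKripke K ⊨st ψ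

_⊨ct_ : {n : ℕ} → FinKripke n → HS n → Set
K ⊨ct ψ = C K ⊨st ψ

module LinearSemantics {n : ℕ} (K : FinKripke n) where
  open FinKripke K

  IsInfPath : (ℕ → Fin m) → Set
  IsInfPath π = ∀ i → δ (π i) (π (suc i)) ≡ true

  -- satisfaction of ψ by the interval [i , j] of π (used only for i ≤ j)
  sat : (ℕ → Fin m) → ℕ → ℕ → HS n → Set
  sat π i j (prop p)  = ∀ h → i ≤ h → h ≤ j → μ (π h) p ≡ true
  sat π i j (neg ψ)   = ¬ sat π i j ψ
  sat π i j (and ψ χ) = sat π i j ψ × sat π i j χ
  sat π i j (⟨B⟩ ψ)   = Σ ℕ λ j' → i ≤ j' × j' < j × sat π i j' ψ
  sat π i j (⟨E⟩ ψ)   = Σ ℕ λ i' → i < i' × i' ≤ j × sat π i' j ψ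
  sat π i j (⟨B̄⟩ ψ)   = Σ ℕ λ j' → j < j' × sat π i j' ψ
  sat π i j (⟨Ē⟩ ψ)   = Σ ℕ λ i' → i' < i × sat π i' j ψ

_⊨lin_ : {n : ℕ} → FinKripke n → HS n → Set
K ⊨lin ψ = ∀ (π : ℕ → Fin m) → IsInfPath π → π 0 ≡ s₀ → ∀ (i : ℕ) → sat π 0 i ψ
  where open FinKripke K
        open LinearSemantics K

-- Linear satisfaction quantifies over the label sequences of initial infinite paths only,
-- so it is reflected along homomorphisms: adding edges to a structure can only make fewer
-- linear formulas true.  The formula "every p-trace extends to a longer p-trace" does not
-- behave this way: with a p-state b leading only to a ¬p sink it fails (on the trace s₀ b,
-- and on the node s₀ b of the computation tree), while adding an edge from b to a p-loop
-- makes it hold, both state-based and computation-tree-based.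
module Submission where

open import Defs
open import Data.Nat using (ℕ)
open import Data.Fin using (Fin; zero; suc)
open import Data.Bool using (Bool; true; false; _∨_)
open import Data.List using (List; []; _∷_; _++_; [_])
open import Data.List.Relation.Unary.All using (All; []; _∷_)
open import Data.List.Relation.Unary.All.Properties using (++⁺)
open import Data.Product using (Σ; _×_; _,_; map₂)
open import Data.Unit using (tt)
open import Data.Empty using (⊥)
open import Function using (_∘_)
open import Relation.Nullary using (¬_)
open import Relation.Binary.PropositionalEquality
  using (_≡_; refl; sym; trans; cong; cong-app; subst)
open import Function.Bundles using (_⇔_; mk⇔; Equivalence)

open Equivalence using (to; from)

IsPath-snoc : {S : Set} (δ : S → S → Set) (x : S) (xs : List S) (t : S) →
              IsPath δ (x ∷ xs) → δ (lst x xs) t → IsPath δ (x ∷ xs ++ [ t ])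
IsPath-snoc δ x []       t _        d = d , tt
IsPath-snoc δ x (y ∷ ys) t (d' , p) d = d' , IsPath-snoc δ y ys t p d

All-lst : {S : Set} {P : S → Set} (x : S) (xs : List S) → All P (x ∷ xs) → P (lst x xs)
All-lst x []       (px ∷ []) = px
All-lst x (y ∷ ys) (_ ∷ ps)  = All-lst y ys ps

lst-snoc : {S : Set} (x : S) (xs : List S) (t : S) → lst x (xs ++ [ t ]) ≡ t
lst-snoc x []       t = refl
lst-snoc x (y ∷ ys) t = lst-snoc y ys t

module _ {n : ℕ} {K K' : FinKripke n} where
  private
    module K  = FinKripke K
    module K' = FinKripke K'
    module L  = LinearSemantics K
    module L' = LinearSemantics K'

  sat-cong : (π : ℕ → Fin K.m) (π' : ℕ → Fin K'.m) →
             (∀ h → K.μ (π h) ≡ K'.μ (π' h)) →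
             ∀ ψ i j → L.sat π i j ψ ⇔ L'.sat π' i j ψ
  sat-cong π π' eq (prop p) i j =
    mk⇔ (λ s h i≤h h≤j → trans (sym (cong-app (eq h) p)) (s h i≤h h≤j))
        (λ s h i≤h h≤j → trans (cong-app (eq h) p) (s h i≤h h≤j))
  sat-cong π π' eq (neg ψ) i j =
    mk⇔ (λ ¬s s' → ¬s (from IH s')) (λ ¬s' s → ¬s' (to IH s))
    where IH = sat-cong π π' eq ψ i j
  sat-cong π π' eq (and ψ χ) i j =
    mk⇔ (λ (s , t) → to IHψ s , to IHχ t) (λ (s , t) → from IHψ s , from IHχ t)
    where IHψ = sat-cong π π' eq ψ i j
          IHχ = sat-cong π π' eq χ i j
  sat-cong π π' eq (⟨B⟩ ψ) i j =
    mk⇔ (λ (k , i≤k , k<j , s) → k , i≤k , k<j , to (sat-cong π π' eq ψ i k) s)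
        (λ (k , i≤k , k<j , s) → k , i≤k , k<j , from (sat-cong π π' eq ψ i k) s)
  sat-cong π π' eq (⟨E⟩ ψ) i j =
    mk⇔ (λ (k , i<k , k≤j , s) → k , i<k , k≤j , to (sat-cong π π' eq ψ k j) s)
        (λ (k , i<k , k≤j , s) → k , i<k , k≤j , from (sat-cong π π' eq ψ k j) s)
  sat-cong π π' eq (⟨B̄⟩ ψ) i j =
    mk⇔ (λ (k , j<k , s) → k , j<k , to (sat-cong π π' eq ψ i k) s)
        (λ (k , j<k , s) → k , j<k , from (sat-cong π π' eq ψ i k) s)
  sat-cong π π' eq (⟨Ē⟩ ψ) i j =
    mk⇔ (λ (k , k<i , s) → k , k<i , to (sat-cong π π' eq ψ k j) s)
        (λ (k , k<i , s) → k , k<i , from (sat-cong π π' eq ψ k j) s)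

record Homomorphism {n : ℕ} (K K' : FinKripke n) : Set where
  private
    module K  = FinKripke K
    module K' = FinKripke K'
  field
    map   : Fin K.m → Fin K'.m
    map-s₀ : map K.s₀ ≡ K'.s₀
    map-δ : ∀ {s t} → K.δ s t ≡ true → K'.δ (map s) (map t) ≡ true
    map-μ : ∀ s → K'.μ (map s) ≡ K.μ s

⊨lin-reflect : {n : ℕ} {K K' : FinKripke n} → Homomorphism K K' →
               ∀ ψ → K' ⊨lin ψ → K ⊨lin ψ
⊨lin-reflect {K = K} {K'} f ψ K'⊨ψ π path π0 i =
  from (sat-cong {K = K} {K'} π (map ∘ π) (sym ∘ map-μ ∘ π) ψ 0 i)
       (K'⊨ψ (map ∘ π) (map-δ ∘ path) (trans (cong map π0) map-s₀) i)
  where open Homomorphism f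

¬lin-definable : {n : ℕ} (⊨X : FinKripke n → Set) {K K' : FinKripke n} →
                 Homomorphism K K' → ⊨X K' → ¬ ⊨X K →
                 ¬ (Σ (HS n) λ ψ' → ∀ K → (K ⊨lin ψ') ⇔ ⊨X K)
¬lin-definable ⊨X f K'⊨X K⊭X (ψ' , equiv) =
  K⊭X (to (equiv _) (⊨lin-reflect f ψ' (from (equiv _) K'⊨X)))

extensible : {n : ℕ} → Fin n → HS n
extensible p = neg (and (prop p) (neg (⟨B̄⟩ (prop p))))

module _ {n : ℕ} (K : Kripke n) (p : Fin n) where
  open Kripke K
  open StateSemantics K

  PSerial : Set
  PSerial = ∀ s → μ s p ≡ true → Σ S λ t → δ s t × μ t p ≡ true

  PDeadEnd : S → Set
  PDeadEnd s = ∀ t → δ s t → μ t p ≡ true → ⊥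

  ⊨st-extensible : PSerial → K ⊨st extensible p
  ⊨st-extensible serial r path (all-p , no-extension)
    with serial (lst s₀ r) (All-lst s₀ r all-p)
  ... | t , d , pt = no-extension (t , [] , IsPath-snoc δ s₀ r t path d , ++⁺ all-p (pt ∷ []))

  ⊭st-extensible : ∀ {b} → μ s₀ p ≡ true → δ s₀ b → μ b p ≡ true → PDeadEnd b →
                   ¬ (K ⊨st extensible p)
  ⊭st-extensible {b} ps₀ d pb dead K⊨ =
    K⊨ [ b ] (d , tt) ((ps₀ ∷ pb ∷ []) , λ where
      (y , _ , (_ , by , _) , (_ ∷ _ ∷ py ∷ _)) → dead y by py)

module _ {n : ℕ} (K : FinKripke n) (p : Fin n) where
  open FinKripke K

  C-PSerial : PSerial (asKripke K) p → PSerial (C K) p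
  C-PSerial serial (r , path) pr with serial (lst s₀ r) pr
  ... | t , d , pt =
    (r ++ [ t ] , IsPath-snoc (Δ K) s₀ r t path d) , (t , refl , d) ,
    subst (λ s → μ s p ≡ true) (sym (lst-snoc s₀ r t)) pt

  C-PDeadEnd : ∀ {b} (d : Δ K s₀ b) → PDeadEnd (asKripke K) p b →
               PDeadEnd (C K) p ([ b ] , d , tt)
  C-PDeadEnd d dead _ (s , refl , bs) ps = dead s bs ps

  ⊨ct-extensible : PSerial (asKripke K) p → K ⊨ct extensible p
  ⊨ct-extensible = ⊨st-extensible (C K) p ∘ C-PSerial

  ⊭ct-extensible : ∀ {b} → μ s₀ p ≡ true → (d : Δ K s₀ b) → μ b p ≡ true →
                   PDeadEnd (asKripke K) p b → ¬ (K ⊨ct extensible p)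
  ⊭ct-extensible {b} ps₀ d pb dead =
    ⊭st-extensible (C K) p {[ b ] , d , tt} ps₀ (b , refl , d) pb (C-PDeadEnd d dead)

pattern s₀ = zero
pattern a  = suc zero
pattern b  = suc (suc zero)
pattern c  = suc (suc (suc zero))

label : Fin 4 → Fin 1 → Bool
label c _ = false
label _ _ = true

δ-trap : Fin 4 → Fin 4 → Bool
δ-trap s₀ a = true
δ-trap s₀ b = true
δ-trap a  a = true
δ-trap b  c = true
δ-trap c  c = true
δ-trap _  _ = false

escape : Fin 4 → Fin 4 → Bool
escape b a = true
escape _ _ = false

δ-escape : Fin 4 → Fin 4 → Bool
δ-escape s t = δ-trap s t ∨ escape s t

δ-trap⊆δ-escape : ∀ {s t} → δ-trap s t ≡ true → δ-escape s t ≡ true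
δ-trap⊆δ-escape e rewrite e = refl

δ-trap-total : ∀ s → Σ (Fin 4) λ t → δ-trap s t ≡ true
δ-trap-total s₀ = a , refl
δ-trap-total a  = a , refl
δ-trap-total b  = c , refl
δ-trap-total c  = c , refl

K-trap K-escape : FinKripke 1
K-trap   = record { m = 4 ; δ = δ-trap ; μ = label ; s₀ = s₀ ; total = δ-trap-total }
K-escape = record { m = 4 ; δ = δ-escape ; μ = label ; s₀ = s₀
                  ; total = map₂ δ-trap⊆δ-escape ∘ δ-trap-total }

K-trap⇒K-escape : Homomorphism K-trap K-escape
K-trap⇒K-escape = record { map = λ s → s ; map-s₀ = refl ; map-δ = δ-trap⊆δ-escape ; map-μ = λ _ → refl }

K-escape-PSerial : PSerial (asKripke K-escape) zero
K-escape-PSerial s₀ _ = a , refl , refl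
K-escape-PSerial a  _ = a , refl , refl
K-escape-PSerial b  _ = a , refl , refl
K-escape-PSerial c  ()

b-PDeadEnd : PDeadEnd (asKripke K-trap) zero b
b-PDeadEnd c _ ()

proposition34 :
    (Σ ℕ λ n → Σ (HS n) λ ψ →
       ¬ (Σ (HS n) λ ψ' → ∀ (K : FinKripke n) → (K ⊨lin ψ') ⇔ (K ⊨ₛₜ ψ)))
    ×
    (Σ ℕ λ n → Σ (HS n) λ χ →
       ¬ (Σ (HS n) λ χ' → ∀ (K : FinKripke n) → (K ⊨lin χ') ⇔ (K ⊨ct χ)))
proposition34 =
  (1 , extensible zero ,
    ¬lin-definable (_⊨ₛₜ extensible zero) K-trap⇒K-escape
      (⊨st-extensible (asKripke K-escape) zero K-escape-PSerial)
      (⊭st-extensible (asKripke K-trap) zero refl refl refl b-PDeadEnd)) ,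
  (1 , extensible zero ,
    ¬lin-definable (_⊨ct extensible zero) K-trap⇒K-escape
      (⊨ct-extensible K-escape zero K-escape-PSerial)
      (⊭ct-extensible K-trap zero refl refl refl b-PDeadEnd))
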